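{- Let $q\ge 2$ be a prime power and let $H_q$ be the graph defined in the context. For any fixed $a\in\mathbb{F}_q$, the vertices of $\{(a,b,c)_1 : b,c\in\mathbb{F}_q\}$ are pairwise at distance at least $4$ in $H_q$. For any fixed $x\in\mathbb{F}_q$, the vertices of $\{(x,y,z)_0 : y,z\in\mathbb{F}_q\}$ are pairwise at distance at least $4$ in $H_q$.
   Context: Let $\mathbb{F}_q$ be the finite field with $q$ elements. $H_q=H_q[U_0,U_1]$ is the bipartite graph with partite sets $U_r=\{(a,b,c)_r : a,b,c\in\mathbb{F}_q\}$, $r=0,1$, in which for all $a,b,c\in\mathbb{F}_q$ the neighbourhood of $(a,b,c)_1$ is $\{(x,\,ax+b,\,a^2x+c)_0 : x\in\mathbb{F}_q\}$. -}

module Defs where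

open import Level using (0ℓ)
open import Data.Nat using (ℕ; zero; suc; _≤_; _<_; _^_)
open import Data.Nat.Primality using (Prime)
open import Data.Fin using (Fin)
open import Data.Product using (_×_; ∃; ∃-syntax)
open import Relation.Nullary using (¬_)
open import Relation.Binary.PropositionalEquality using (_≡_)
open import Algebra.Structures using (IsCommutativeRing)
open import Function.Bundles using (_↔_)

IsPrimePower : ℕ → Set
IsPrimePower q = ∃[ p ] ∃[ k ] (Prime p × 1 ≤ k × q ≡ p ^ k)

record FiniteField (q : ℕ) : Set₁ where
  infixl 6 _+_
  infixl 7 _*_
  field
    Carrier : Set
    _+_ _*_ : Carrier → Carrier → Carrier
    -_      : Carrier → Carrier
    0# 1#   : Carrier
    isCommutativeRing : IsCommutativeRing _≡_ _+_ _*_ -_ 0# 1#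
    0≢1     : ¬ (0# ≡ 1#)
    inverse : ∀ x → ¬ (x ≡ 0#) → ∃[ y ] (x * y ≡ 1#)
    card    : Carrier ↔ Fin q

module H {q : ℕ} (F : FiniteField q) where
  open FiniteField F

  data Vertex : Set where
    v0 : Carrier → Carrier → Carrier → Vertex
    v1 : Carrier → Carrier → Carrier → Vertex

  data Adj : Vertex → Vertex → Set where
    adj10 : ∀ {a b c x y z} → y ≡ a * x + b → z ≡ (a * a) * x + c →
            Adj (v1 a b c) (v0 x y z)
    adj01 : ∀ {a b c x y z} → y ≡ a * x + b → z ≡ (a * a) * x + c →
            Adj (v0 x y z) (v1 a b c)

  data Walk : Vertex → Vertex → ℕ → Set where
    here : ∀ {u} → Walk u u 0
    step : ∀ {u v w n} → Adj u v → Walk v w n → Walk u w (suc n)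

  DistAtLeast : ℕ → Vertex → Vertex → Set
  DistAtLeast d u v = ∀ n → n < d → ¬ Walk u v n

-- H_q is bipartite, so two vertices on the same side are joined by no walk of
-- length 1 or 3, and a walk of length 2 between them passes through a common
-- neighbour. Two vertices (a,b,c)_1, (a,b′,c′)_1 with a common neighbour (x,y,z)_0
-- satisfy a x + b = y = a x + b′ and a² x + c = z = a² x + c′, hence b = b′ and
-- c = c′; a neighbour (a,b,c)_1 of (x,y,z)_0 determines y = a x + b, z = a² x + c.
module Submission where

open import Defs
open import Data.Bool using (Bool; true; false; not)
open import Data.Bool.Properties using (not-¬)
open import Data.Nat using (ℕ; zero; suc; _≤_; s≤s)
open import Data.Product using (_×_; _,_)
open import Relation.Nullary using (¬_)
open import Relation.Binary.PropositionalEquality using (_≡_; refl; sym; trans)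
open import Algebra.Bundles using (Group)
open import Algebra.Structures using (IsCommutativeRing)
import Algebra.Properties.Group as GroupProperties

module _ {q : ℕ} (F : FiniteField q) where
  open FiniteField F
  open H F

  +-group : Group _ _
  +-group = record { isGroup = IsCommutativeRing.+-isGroup isCommutativeRing }

  open GroupProperties +-group using (∙-cancelˡ)

  inU₁ : Vertex → Bool
  inU₁ (v0 _ _ _) = false
  inU₁ (v1 _ _ _) = true

  flipped : ℕ → Bool → Bool
  flipped zero    s = s
  flipped (suc n) s = flipped n (not s)

  adj-switches-side : ∀ {u v} → Adj u v → inU₁ v ≡ not (inU₁ u)
  adj-switches-side (adj10 _ _) = refl
  adj-switches-side (adj01 _ _) = refl

  walk-side : ∀ {u w n} → Walk u w n → inU₁ w ≡ flipped n (inU₁ u)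
  walk-side here          = refl
  walk-side (step e walk) rewrite walk-side walk | adj-switches-side e = refl

  common-neighbour-U₁ : ∀ {a b c b′ c′ v} → Adj (v1 a b c) v → Adj v (v1 a b′ c′) →
                        b ≡ b′ × c ≡ c′
  common-neighbour-U₁ (adj10 y≡ z≡) (adj01 y≡′ z≡′) =
    ∙-cancelˡ _ _ _ (trans (sym y≡) y≡′) , ∙-cancelˡ _ _ _ (trans (sym z≡) z≡′)

  common-neighbour-U₀ : ∀ {x y z y′ z′ v} → Adj (v0 x y z) v → Adj v (v0 x y′ z′) →
                        y ≡ y′ × z ≡ z′
  common-neighbour-U₀ (adj01 y≡ z≡) (adj10 y≡′ z≡′) = trans y≡ (sym y≡′) , trans z≡ (sym z≡′)

  U₁-fibres-far-apart : (a b c b′ c′ : Carrier) → ¬ (b ≡ b′ × c ≡ c′) →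
                        DistAtLeast 4 (v1 a b c) (v1 a b′ c′)
  U₁-fibres-far-apart a b c b′ c′ distinct = λ where
    0 _ here → distinct (refl , refl)
    1 _ walk → not-¬ refl (walk-side walk)
    2 _ (step e (step e′ here)) → distinct (common-neighbour-U₁ e e′)
    3 _ walk → not-¬ refl (walk-side walk)
    (suc (suc (suc (suc _)))) (s≤s (s≤s (s≤s (s≤s ())))) _

  U₀-fibres-far-apart : (x y z y′ z′ : Carrier) → ¬ (y ≡ y′ × z ≡ z′) →
                        DistAtLeast 4 (v0 x y z) (v0 x y′ z′)
  U₀-fibres-far-apart x y z y′ z′ distinct = λ where
    0 _ here → distinct (refl , refl)
    1 _ walk → not-¬ refl (walk-side walk)
    2 _ (step e (step e′ here)) → distinct (common-neighbour-U₀ e e′)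
    3 _ walk → not-¬ refl (walk-side walk)
    (suc (suc (suc (suc _)))) (s≤s (s≤s (s≤s (s≤s ())))) _

lemma1 : (q : ℕ) → 2 ≤ q → IsPrimePower q → (F : FiniteField q) →
    ((a b c b′ c′ : FiniteField.Carrier F) → ¬ (b ≡ b′ × c ≡ c′) →
    H.DistAtLeast F 4 (H.v1 a b c) (H.v1 a b′ c′))
    × ((x y z y′ z′ : FiniteField.Carrier F) → ¬ (y ≡ y′ × z ≡ z′) →
    H.DistAtLeast F 4 (H.v0 x y z) (H.v0 x y′ z′))
lemma1 _ _ _ F = U₁-fibres-far-apart F , U₀-fibres-far-apart F
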